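{- Let $\Delta_c$ be a concrete first-order unification context, let $T$ be a concrete term, let $\Delta_1$ be a (flattened) unification context, and let $k\ge 0$. Suppose that $\mathrm{exp}^{\Delta_c}_k(\underline s)=\mathrm{exp}^{\Delta_1}_k(\underline s)$ for every recursion constant $\underline s$ occurring in $T$. Then: (1) if $T \rhd^{\mathrm{con}} U \diamond \Delta_2$, then $\mathrm{exp}^{\Delta_c}_k(T)=\mathrm{exp}^{\Delta_1,\Delta_2}_k(U)$; (2) if $T \rhd^{\mathrm{rec}} N \diamond \Delta_2$, then $\mathrm{exp}^{\Delta_c}_k(T)=\mathrm{exp}^{\Delta_1,\Delta_2}_k(N)$.
   Context: Fix constructors $c,d,e$ (each with an arity), unification metavariables $H,G,\dots$, and recursion constants $\underline r,\underline s,\underline t$. Concrete syntax: concrete terms $T ::= c\,T_1\cdots T_n \mid H \mid \underline r$; a concrete unification context $\Delta_c$ is a finite list of equations $T_1\doteq T_2$ and recursive definitions $\underline r =_d c\,T_1\cdots T_n$ (the body always has a constructor head). Flattened syntax: each unification metavariable is tagged contractive ($H^{\mathrm{con}}$) or recursive ($H^{\mathrm{rec}}$). Contractive terms $U ::= c\,N_1\cdots N_n \mid H^{\mathrm{con}}$; recursive terms $N ::= \underline r \mid H^{\mathrm{rec}}$. A unification context $\Delta$ is a finite collection of equations $U_1\doteq U_2$, equations $N_1\doteq N_2$, recursive definitions $\underline r =_d U$, and possibly a symbol $\mathrm{contra}$. For contexts $\Delta_1,\Delta_2$, the union $\Delta_1,\Delta_2$ is formed after consistently renaming recursion constants of $\Delta_2$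 so the defined constants are disjoint. Depth-$k$ expansion into $M_\bot ::= c\,(M_\bot)_1\cdots(M_\bot)_n \mid H^{\mathrm{con}}\mid H^{\mathrm{rec}}\mid \bot$: for concrete terms, $\mathrm{exp}^{\Delta_c}_0(T)=\bot$; $\mathrm{exp}^{\Delta_c}_{k+1}(c\,T_1\cdots T_n)=c\,(\mathrm{exp}^{\Delta_c}_k(T_1))\cdots(\mathrm{exp}^{\Delta_c}_k(T_n))$; $\mathrm{exp}^{\Delta_c}_{k+1}(H)=H^{\mathrm{rec}}$; $\mathrm{exp}^{\Delta_c}_{k+1}(\underline r)=\mathrm{exp}^{\Delta_c}_{k+1}(c\,T_1\cdots T_n)$ where $\underline r=_d c\,T_1\cdots T_n\in\Delta_c$. For flattened terms, $\mathrm{exp}^\Delta_0(M)=\bot$; $\mathrm{exp}^\Delta_{k+1}(H^{m})=H^{m}$; $\mathrm{exp}^\Delta_{k+1}(c\,N_1\cdots N_n)=c\,(\mathrm{exp}^\Delta_k(N_1))\cdots(\mathrm{exp}^\Delta_k(N_n))$; $\mathrm{exp}^\Delta_{k+1}(\underline r)=\mathrm{exp}^\Delta_{k+1}(U)$ where $\underline r=_d U\in\Delta$. Translation judgments are defined inductively by: (i) $H \rhd^{\mathrm{rec}} H^{\mathrm{rec}}\diamond[\,]$; (ii) $\underline r\rhd^{\mathrm{rec}}\underline r\diamond[\,]$; (iii) if $c\,T_1\cdots T_n\rhd^{\mathrm{con}}U\diamond\Delta$ then $c\,T_1\cdots T_n\rhd^{\mathrm{rec}}\underline r\diamond(\Delta,\underline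 r=_d U)$ for a fresh recursion constant $\underline r$; (iv) if $T_i\rhd^{\mathrm{rec}}N_i\diamond\Delta_i$ for $1\le i\le n$ then $c\,T_1\cdots T_n\rhd^{\mathrm{con}} c\,N_1\cdots N_n\diamond(\Delta_1,\dots,\Delta_n)$ (there are no $\rhd^{\mathrm{con}}$ rules for $H$ or $\underline r$). Fresh recursion constants are chosen not to occur in $\Delta_c$ or $\Delta_1$. -}

module Defs where

open import Data.Nat using (ℕ; zero; suc; _≟_)
open import Relation.Nullary using (yes; no)
open import Data.Vec using (Vec; []; _∷_)
open import Data.List using (List; []; _∷_; _++_; [_])
open import Data.List.Membership.Propositional using (_∈_; _∉_)
open import Data.Maybe using (Maybe; just; nothing)
open import Data.Product using (Σ; _×_; _,_)
open import Relation.Binary.PropositionalEquality using (_≡_)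

record Signature : Set₁ where
  field
    Con   : Set
    arity : Con → ℕ
open Signature public

MVar : Set
MVar = ℕ

RConst : Set
RConst = ℕ

data Mode : Set where
  con rec : Mode

module WithSig (S : Signature) where

  data CTerm : Set where
    ccon : (c : Con S) → Vec CTerm (arity S c) → CTerm
    cmv  : MVar → CTerm
    crc  : RConst → CTerm

  data CEntry : Set where
    ceq  : CTerm → CTerm → CEntry
    cdef : RConst → (c : Con S) → Vec CTerm (arity S c) → CEntry

  CCtx : Set
  CCtx = List CEntry

  mutual
    data UTerm : Set where
      ucon : (c : Con S) → Vec NTerm (arity S c) → UTerm
      uhcon : MVar → UTerm
    data NTerm : Set where
      nrc   : RConst → NTerm
      nhrec : MVar → NTerm

  data FEntry : Set where
    ueq    : UTerm → UTerm → FEntry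
    neq    : NTerm → NTerm → FEntry
    fdef   : RConst → UTerm → FEntry
    contra : FEntry

  FCtx : Set
  FCtx = List FEntry

  -- Union of flattened contexts (recursion constants are assumed already
  -- disjoint by freshness, see the translation judgments below).
  _,,_ : FCtx → FCtx → FCtx
  Δ₁ ,, Δ₂ = Δ₁ ++ Δ₂

  data MBot : Set where
    mcon : (c : Con S) → Vec MBot (arity S c) → MBot
    mh   : Mode → MVar → MBot
    bot  : MBot

  mutual
    rcsC : CTerm → List RConst
    rcsC (ccon c Ts) = rcsCs Ts
    rcsC (cmv H) = []
    rcsC (crc r) = [ r ]

    rcsCs : ∀ {n} → Vec CTerm n → List RConst
    rcsCs [] = []
    rcsCs (T ∷ Ts) = rcsC T ++ rcsCs Ts

  rcsCCtx : CCtx → List RConst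
  rcsCCtx [] = []
  rcsCCtx (ceq T₁ T₂ ∷ Δ) = rcsC T₁ ++ rcsC T₂ ++ rcsCCtx Δ
  rcsCCtx (cdef r c Ts ∷ Δ) = r ∷ rcsCs Ts ++ rcsCCtx Δ

  rcsN : NTerm → List RConst
  rcsN (nrc r) = [ r ]
  rcsN (nhrec H) = []

  rcsNs : ∀ {n} → Vec NTerm n → List RConst
  rcsNs [] = []
  rcsNs (N ∷ Ns) = rcsN N ++ rcsNs Ns

  rcsU : UTerm → List RConst
  rcsU (ucon c Ns) = rcsNs Ns
  rcsU (uhcon H) = []

  rcsFCtx : FCtx → List RConst
  rcsFCtx [] = []
  rcsFCtx (ueq U₁ U₂ ∷ Δ) = rcsU U₁ ++ rcsU U₂ ++ rcsFCtx Δ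
  rcsFCtx (neq N₁ N₂ ∷ Δ) = rcsN N₁ ++ rcsN N₂ ++ rcsFCtx Δ
  rcsFCtx (fdef r U ∷ Δ) = r ∷ rcsU U ++ rcsFCtx Δ
  rcsFCtx (contra ∷ Δ) = rcsFCtx Δ

  defsF : FCtx → List RConst
  defsF [] = []
  defsF (fdef r U ∷ Δ) = r ∷ defsF Δ
  defsF (_ ∷ Δ) = defsF Δ

  Disjoint : List RConst → List RConst → Set
  Disjoint xs ys = ∀ {x} → x ∈ xs → x ∉ ys

  data CBody : Set where
    cbody : (c : Con S) → Vec CTerm (arity S c) → CBody

  lookupC : CCtx → RConst → Maybe CBody
  lookupC [] r = nothing
  lookupC (ceq _ _ ∷ Δ) r = lookupC Δ r
  lookupC (cdef r' c Ts ∷ Δ) r with r ≟ r'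
  ... | yes _ = just (cbody c Ts)
  ... | no _ = lookupC Δ r

  lookupF : FCtx → RConst → Maybe UTerm
  lookupF [] r = nothing
  lookupF (fdef r' U ∷ Δ) r with r ≟ r'
  ... | yes _ = just U
  ... | no _ = lookupF Δ r
  lookupF (_ ∷ Δ) r = lookupF Δ r

  -- Depth-k expansion (partial: `nothing` when an undefined recursion
  -- constant has to be unfolded)
  mutual
    expC : CCtx → ℕ → CTerm → Maybe MBot
    expC Δ zero T = just bot
    expC Δ (suc k) (ccon c Ts) = expCcon Δ k c Ts
    expC Δ (suc k) (cmv H) = just (mh rec H)
    expC Δ (suc k) (crc r) with lookupC Δ r
    ... | just (cbody c Ts) = expCcon Δ k c Ts
    ... | nothing = nothing

    expCcon : CCtx → ℕ → (c : Con S) → Vec CTerm (arity S c) → Maybe MBot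
    expCcon Δ k c Ts with expCs Δ k Ts
    ... | just Ms = just (mcon c Ms)
    ... | nothing = nothing

    expCs : ∀ {n} → CCtx → ℕ → Vec CTerm n → Maybe (Vec MBot n)
    expCs Δ k [] = just []
    expCs Δ k (T ∷ Ts) with expC Δ k T | expCs Δ k Ts
    ... | just M | just Ms = just (M ∷ Ms)
    ... | _ | _ = nothing

  mkcon : (c : Con S) → Maybe (Vec MBot (arity S c)) → Maybe MBot
  mkcon c (just Ms) = just (mcon c Ms)
  mkcon c nothing = nothing

  mcons : ∀ {n} → Maybe MBot → Maybe (Vec MBot n) → Maybe (Vec MBot (suc n))
  mcons (just M) (just Ms) = just (M ∷ Ms)
  mcons _ _ = nothing

  mutual
    expU : FCtx → ℕ → UTerm → Maybe MBot
    expU Δ zero U = just bot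
    expU Δ (suc k) U = expU+ Δ k U

    -- expU+ Δ k U = exp^Δ_{k+1}(U)
    expU+ : FCtx → ℕ → UTerm → Maybe MBot
    expU+ Δ k (uhcon H) = just (mh con H)
    expU+ Δ k (ucon c Ns) = mkcon c (expNs Δ k Ns)

    expN : FCtx → ℕ → NTerm → Maybe MBot
    expN Δ zero N = just bot
    expN Δ (suc k) (nhrec H) = just (mh rec H)
    expN Δ (suc k) (nrc r) = expBody Δ k (lookupF Δ r)

    expBody : FCtx → ℕ → Maybe UTerm → Maybe MBot
    expBody Δ k (just U) = expU+ Δ k U
    expBody Δ k nothing = nothing

    expNs : ∀ {n} → FCtx → ℕ → Vec NTerm n → Maybe (Vec MBot n)
    expNs Δ k [] = just []
    expNs Δ k (N ∷ Ns) = mcons (expN Δ k N) (expNs Δ k Ns)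

  module Translation (Δc : CCtx) (Δ₁ : FCtx) where

    Fresh : RConst → FCtx → Set
    Fresh r Δ = (r ∉ rcsCCtx Δc) × (r ∉ rcsFCtx Δ₁) × (r ∉ rcsFCtx Δ)

    mutual
      data _▷rec_◇_ : CTerm → NTerm → FCtx → Set where
        tr-mv  : ∀ {H} → cmv H ▷rec nhrec H ◇ []
        tr-rc  : ∀ {r} → crc r ▷rec nrc r ◇ []
        tr-con : ∀ {c Ts U Δ} r → Fresh r Δ →
                 ccon c Ts ▷con U ◇ Δ →
                 ccon c Ts ▷rec nrc r ◇ (Δ ,, [ fdef r U ])

      data _▷con_◇_ : CTerm → UTerm → FCtx → Set where
        tc-con : ∀ {c Ts Ns Δ} → Ts ▷recs Ns ◇ Δ → ccon c Ts ▷con ucon c Ns ◇ Δ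

      data _▷recs_◇_ : ∀ {n} → Vec CTerm n → Vec NTerm n → FCtx → Set where
        trs-[] : [] ▷recs [] ◇ []
        trs-∷  : ∀ {n T N Δ} {Ts : Vec CTerm n} {Ns Δs} →
                 T ▷rec N ◇ Δ → Ts ▷recs Ns ◇ Δs →
                 Disjoint (defsF Δ) (defsF Δs) →
                 (T ∷ Ts) ▷recs (N ∷ Ns) ◇ (Δ ,, Δs)

-- Both expansions unfold a term layer by layer, and the translation replaces each
-- constructor application below the root by a fresh recursion constant whose
-- definition is that very application.  Unfolding such a constant in the extended
-- context therefore produces exactly the layer the concrete expansion produces, so
-- the two expansions agree by induction on the depth and the translation
-- derivation.  Freshness makes the definitions of Δ₂ visible unchanged in Δ₁ ,, Δ₂,
-- while the constants already occurring in T keep their Δ₁-expansion because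
-- expansion is monotone under extending a context and, at smaller depths, is the
-- truncation of the expansion at the given depth.
module Submission where

open import Defs
open import Data.Nat using (ℕ; zero; suc; _≟_)
open import Data.Maybe using (Maybe; just; nothing)
open import Data.Product using (Σ; _×_; _,_)
open import Data.Vec using (Vec; []; _∷_)
open import Data.List using (List; []; _∷_; _++_; [_])
open import Data.List.Relation.Unary.Any using (here; there)
open import Data.List.Membership.Propositional using (_∈_; _∉_)
open import Data.List.Membership.Propositional.Properties using (∈-++⁺ˡ; ∈-++⁺ʳ; ∈-++⁻)
open import Data.Sum using (_⊎_; inj₁; inj₂)
open import Data.Empty using (⊥-elim)
open import Relation.Nullary using (yes; no)
open import Relation.Binary.PropositionalEquality
  using (_≡_; refl; sym; trans; cong; cong₂; subst)

module ExpansionProperties (S : Signature) where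
  open WithSig S

  mcons-inv : ∀ {n} (a : Maybe MBot) (b : Maybe (Vec MBot n)) {v} → mcons a b ≡ just v →
    Σ MBot λ M → Σ (Vec MBot n) λ Ms → (a ≡ just M) × (b ≡ just Ms) × (v ≡ M ∷ Ms)
  mcons-inv (just M) (just Ms) refl = M , Ms , refl , refl , refl

  mkcon-inv : ∀ c (a : Maybe (Vec MBot (arity S c))) {m} → mkcon c a ≡ just m →
    Σ (Vec MBot (arity S c)) λ Ms → (a ≡ just Ms) × (m ≡ mcon c Ms)
  mkcon-inv c (just Ms) refl = Ms , refl , refl

  expCs-∷ : ∀ Δ k {n} T (Ts : Vec CTerm n) →
    expCs Δ k (T ∷ Ts) ≡ mcons (expC Δ k T) (expCs Δ k Ts)
  expCs-∷ Δ k T Ts with expC Δ k T | expCs Δ k Ts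
  ... | just _  | just _  = refl
  ... | just _  | nothing = refl
  ... | nothing | just _  = refl
  ... | nothing | nothing = refl

  expCcon≡mkcon : ∀ Δ k c Ts → expCcon Δ k c Ts ≡ mkcon c (expCs Δ k Ts)
  expCcon≡mkcon Δ k c Ts with expCs Δ k Ts
  ... | just _  = refl
  ... | nothing = refl

  mutual
    cut : ℕ → MBot → MBot
    cut zero    m           = bot
    cut (suc k) (mcon c Ms) = mcon c (cuts k Ms)
    cut (suc k) (mh x H)    = mh x H
    cut (suc k) bot         = bot

    cuts : ∀ {n} → ℕ → Vec MBot n → Vec MBot n
    cuts k []       = []
    cuts k (M ∷ Ms) = cut k M ∷ cuts k Ms

  mutual
    expC-cut : ∀ Δ k T {m} → expC Δ (suc k) T ≡ just m → expC Δ k T ≡ just (cut k m)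
    expC-cut Δ zero    T           e    = refl
    expC-cut Δ (suc k) (cmv H)     refl = refl
    expC-cut Δ (suc k) (ccon c Ts) e    = expCcon-cut Δ k c Ts e
    expC-cut Δ (suc k) (crc r)     e with lookupC Δ r
    ... | just (cbody c Ts) = expCcon-cut Δ k c Ts e

    expCcon-cut : ∀ Δ k c Ts {m} → expCcon Δ (suc k) c Ts ≡ just m →
      expCcon Δ k c Ts ≡ just (cut (suc k) m)
    expCcon-cut Δ k c Ts e
      with mkcon-inv c (expCs Δ (suc k) Ts) (trans (sym (expCcon≡mkcon Δ (suc k) c Ts)) e)
    ... | Ms , eMs , refl = trans (expCcon≡mkcon Δ k c Ts) (cong (mkcon c) (expCs-cut Δ k Ts eMs))

    expCs-cut : ∀ Δ k {n} (Ts : Vec CTerm n) {Ms} → expCs Δ (suc k) Ts ≡ just Ms →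
      expCs Δ k Ts ≡ just (cuts k Ms)
    expCs-cut Δ k []       refl = refl
    expCs-cut Δ k (T ∷ Ts) e
      with mcons-inv (expC Δ (suc k) T) (expCs Δ (suc k) Ts) (trans (sym (expCs-∷ Δ (suc k) T Ts)) e)
    ... | M , Ms , eM , eMs , refl =
      trans (expCs-∷ Δ k T Ts) (cong₂ mcons (expC-cut Δ k T eM) (expCs-cut Δ k Ts eMs))

  mutual
    expN-cut : ∀ Δ k N {m} → expN Δ (suc k) N ≡ just m → expN Δ k N ≡ just (cut k m)
    expN-cut Δ zero    N         e    = refl
    expN-cut Δ (suc k) (nhrec H) refl = refl
    expN-cut Δ (suc k) (nrc r)   e with lookupF Δ r
    ... | just U = expU+-cut Δ k U e

    expU+-cut : ∀ Δ k U {m} → expU+ Δ (suc k) U ≡ just m → expU+ Δ k U ≡ just (cut (suc k) m)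
    expU+-cut Δ k (uhcon H)   refl = refl
    expU+-cut Δ k (ucon c Ns) e with mkcon-inv c (expNs Δ (suc k) Ns) e
    ... | Ms , eMs , refl = cong (mkcon c) (expNs-cut Δ k Ns eMs)

    expNs-cut : ∀ Δ k {n} (Ns : Vec NTerm n) {Ms} → expNs Δ (suc k) Ns ≡ just Ms →
      expNs Δ k Ns ≡ just (cuts k Ms)
    expNs-cut Δ k []       refl = refl
    expNs-cut Δ k (N ∷ Ns) e with mcons-inv (expN Δ (suc k) N) (expNs Δ (suc k) Ns) e
    ... | M , Ms , eM , eMs , refl = cong₂ mcons (expN-cut Δ k N eM) (expNs-cut Δ k Ns eMs)

  lookupF-++⁺ : ∀ Δ X r {U} → lookupF Δ r ≡ just U → lookupF (Δ ++ X) r ≡ just U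
  lookupF-++⁺ (ueq _ _ ∷ Δ)    X r e = lookupF-++⁺ Δ X r e
  lookupF-++⁺ (neq _ _ ∷ Δ)    X r e = lookupF-++⁺ Δ X r e
  lookupF-++⁺ (contra ∷ Δ)     X r e = lookupF-++⁺ Δ X r e
  lookupF-++⁺ (fdef r' _ ∷ Δ)  X r e with r ≟ r'
  ... | yes _ = e
  ... | no _  = lookupF-++⁺ Δ X r e

  mutual
    expN-++ : ∀ Δ X k N {m} → expN Δ k N ≡ just m → expN (Δ ++ X) k N ≡ just m
    expN-++ Δ X zero    N         e = e
    expN-++ Δ X (suc k) (nhrec H) e = e
    expN-++ Δ X (suc k) (nrc r)   e with lookupF Δ r in eq
    ... | just U rewrite lookupF-++⁺ Δ X r eq = expU+-++ Δ X k U e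

    expU+-++ : ∀ Δ X k U {m} → expU+ Δ k U ≡ just m → expU+ (Δ ++ X) k U ≡ just m
    expU+-++ Δ X k (uhcon H)   e = e
    expU+-++ Δ X k (ucon c Ns) e with mkcon-inv c (expNs Δ k Ns) e
    ... | Ms , eMs , refl = cong (mkcon c) (expNs-++ Δ X k Ns eMs)

    expNs-++ : ∀ Δ X k {n} (Ns : Vec NTerm n) {Ms} → expNs Δ k Ns ≡ just Ms →
      expNs (Δ ++ X) k Ns ≡ just Ms
    expNs-++ Δ X k []       e = e
    expNs-++ Δ X k (N ∷ Ns) e with mcons-inv (expN Δ k N) (expNs Δ k Ns) e
    ... | M , Ms , eM , eMs , refl = cong₂ mcons (expN-++ Δ X k N eM) (expNs-++ Δ X k Ns eMs)

  defsF-++ : ∀ Δ X → defsF (Δ ++ X) ≡ defsF Δ ++ defsF X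
  defsF-++ []              X = refl
  defsF-++ (ueq _ _ ∷ Δ)   X = defsF-++ Δ X
  defsF-++ (neq _ _ ∷ Δ)   X = defsF-++ Δ X
  defsF-++ (contra ∷ Δ)    X = defsF-++ Δ X
  defsF-++ (fdef r _ ∷ Δ)  X = cong (r ∷_) (defsF-++ Δ X)

  ∈-defsF-++⁺ˡ : ∀ Δ X {r} → r ∈ defsF Δ → r ∈ defsF (Δ ++ X)
  ∈-defsF-++⁺ˡ Δ X r∈ = subst (_ ∈_) (sym (defsF-++ Δ X)) (∈-++⁺ˡ r∈)

  ∈-defsF-++⁺ʳ : ∀ Δ X {r} → r ∈ defsF X → r ∈ defsF (Δ ++ X)
  ∈-defsF-++⁺ʳ Δ X r∈ = subst (_ ∈_) (sym (defsF-++ Δ X)) (∈-++⁺ʳ (defsF Δ) r∈)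

  ∈-defsF-++⁻ : ∀ Δ X {r} → r ∈ defsF (Δ ++ X) → r ∈ defsF Δ ⊎ r ∈ defsF X
  ∈-defsF-++⁻ Δ X r∈ = ∈-++⁻ (defsF Δ) (subst (_ ∈_) (defsF-++ Δ X) r∈)

  defsF⊆rcsFCtx : ∀ Δ {r} → r ∈ defsF Δ → r ∈ rcsFCtx Δ
  defsF⊆rcsFCtx (ueq U₁ U₂ ∷ Δ) r∈ = ∈-++⁺ʳ (rcsU U₁) (∈-++⁺ʳ (rcsU U₂) (defsF⊆rcsFCtx Δ r∈))
  defsF⊆rcsFCtx (neq N₁ N₂ ∷ Δ) r∈ = ∈-++⁺ʳ (rcsN N₁) (∈-++⁺ʳ (rcsN N₂) (defsF⊆rcsFCtx Δ r∈))
  defsF⊆rcsFCtx (contra ∷ Δ)    r∈ = defsF⊆rcsFCtx Δ r∈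
  defsF⊆rcsFCtx (fdef r U ∷ Δ)  (here eq)  = here eq
  defsF⊆rcsFCtx (fdef r U ∷ Δ)  (there r∈) = there (∈-++⁺ʳ (rcsU U) (defsF⊆rcsFCtx Δ r∈))

  lookupF-++ˡ : ∀ Δ X r → r ∈ defsF Δ → lookupF (Δ ++ X) r ≡ lookupF Δ r
  lookupF-++ˡ (ueq _ _ ∷ Δ)   X r r∈ = lookupF-++ˡ Δ X r r∈
  lookupF-++ˡ (neq _ _ ∷ Δ)   X r r∈ = lookupF-++ˡ Δ X r r∈
  lookupF-++ˡ (contra ∷ Δ)    X r r∈ = lookupF-++ˡ Δ X r r∈
  lookupF-++ˡ (fdef r' _ ∷ Δ) X r r∈ with r ≟ r' | r∈
  ... | yes _  | _         = refl
  ... | no r≢  | here r≡   = ⊥-elim (r≢ r≡)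
  ... | no _   | there r∈Δ = lookupF-++ˡ Δ X r r∈Δ

  lookupF-++ʳ : ∀ Δ X r → r ∉ defsF Δ → lookupF (Δ ++ X) r ≡ lookupF X r
  lookupF-++ʳ []              X r r∉ = refl
  lookupF-++ʳ (ueq _ _ ∷ Δ)   X r r∉ = lookupF-++ʳ Δ X r r∉
  lookupF-++ʳ (neq _ _ ∷ Δ)   X r r∉ = lookupF-++ʳ Δ X r r∉
  lookupF-++ʳ (contra ∷ Δ)    X r r∉ = lookupF-++ʳ Δ X r r∉
  lookupF-++ʳ (fdef r' _ ∷ Δ) X r r∉ with r ≟ r'
  ... | yes r≡ = ⊥-elim (r∉ (here r≡))
  ... | no _   = lookupF-++ʳ Δ X r (λ r∈ → r∉ (there r∈))

  lookupF-fdef : ∀ r U → lookupF [ fdef r U ] r ≡ just U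
  lookupF-fdef r U with r ≟ r
  ... | yes _ = refl
  ... | no r≢ = ⊥-elim (r≢ refl)

  Extends : FCtx → FCtx → Set
  Extends G Δ = ∀ r → r ∈ defsF Δ → lookupF G r ≡ lookupF Δ r

  Extends-++ˡ : ∀ G Δ X → Extends G (Δ ++ X) → Extends G Δ
  Extends-++ˡ G Δ X ext r r∈ = trans (ext r (∈-defsF-++⁺ˡ Δ X r∈)) (lookupF-++ˡ Δ X r r∈)

  Extends-++ʳ : ∀ G Δ X → Disjoint (defsF Δ) (defsF X) → Extends G (Δ ++ X) → Extends G X
  Extends-++ʳ G Δ X disj ext r r∈ =
    trans (ext r (∈-defsF-++⁺ʳ Δ X r∈)) (lookupF-++ʳ Δ X r (λ r∈Δ → disj r∈Δ r∈))

  Extends-++ : ∀ Δ X → Disjoint (defsF X) (defsF Δ) → Extends (Δ ++ X) X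
  Extends-++ Δ X disj r r∈ = lookupF-++ʳ Δ X r (disj r∈)

  -- Definedness is part of agreement: it is what lets agreement descend to smaller depths.
  record Agree (Δc : CCtx) (Δ : FCtx) (k : ℕ) (s : RConst) : Set where
    constructor agree
    field
      value : MBot
      expC≡ : expC Δc k (crc s) ≡ just value
      expN≡ : expN Δ k (nrc s) ≡ just value

  Agree-pred : ∀ {Δc Δ k s} → Agree Δc Δ (suc k) s → Agree Δc Δ k s
  Agree-pred {Δc} {Δ} {k} {s} (agree m eC eN) =
    agree (cut k m) (expC-cut Δc k (crc s) eC) (expN-cut Δ k (nrc s) eN)

  Agree-++ : ∀ {Δc Δ k s} X → Agree Δc Δ k s → Agree Δc (Δ ++ X) k s
  Agree-++ {Δ = Δ} {k} {s} X (agree m eC eN) = agree m eC (expN-++ Δ X k (nrc s) eN)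

  module Soundness (Δc : CCtx) (Δ₁ : FCtx) where
    open Translation Δc Δ₁

    mutual
      ▷rec-defs-fresh : ∀ {T N Δ} → T ▷rec N ◇ Δ → Disjoint (defsF Δ) (rcsFCtx Δ₁)
      ▷rec-defs-fresh tr-mv ()
      ▷rec-defs-fresh tr-rc ()
      ▷rec-defs-fresh (tr-con {U = U} {Δ = Δ} r (_ , r∉Δ₁ , _) d) r∈
        with ∈-defsF-++⁻ Δ [ fdef r U ] r∈
      ... | inj₁ r∈Δ         = ▷con-defs-fresh d r∈Δ
      ... | inj₂ (here refl) = r∉Δ₁

      ▷con-defs-fresh : ∀ {T U Δ} → T ▷con U ◇ Δ → Disjoint (defsF Δ) (rcsFCtx Δ₁)
      ▷con-defs-fresh (tc-con ds) = ▷recs-defs-fresh ds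

      ▷recs-defs-fresh : ∀ {n} {Ts : Vec CTerm n} {Ns Δ} → Ts ▷recs Ns ◇ Δ →
        Disjoint (defsF Δ) (rcsFCtx Δ₁)
      ▷recs-defs-fresh trs-[] ()
      ▷recs-defs-fresh (trs-∷ {Δ = Δ} {Δs = Δs} d ds _) r∈ with ∈-defsF-++⁻ Δ Δs r∈
      ... | inj₁ r∈Δ  = ▷rec-defs-fresh d r∈Δ
      ... | inj₂ r∈Δs = ▷recs-defs-fresh ds r∈Δs

    module _ (G : FCtx) where
      AgreeOn : List RConst → ℕ → Set
      AgreeOn rs k = ∀ s → s ∈ rs → Agree Δc G k s

      mutual
        ▷con-sound : ∀ k {T U Δ} → T ▷con U ◇ Δ → AgreeOn (rcsC T) k → Extends G Δ →
          expC Δc k T ≡ expU G k U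
        ▷con-sound zero    _                               _      _   = refl
        ▷con-sound (suc k) (tc-con {c = c} {Ts = Ts} ds) agrees ext =
          trans (expCcon≡mkcon Δc k c Ts)
                (cong (mkcon c) (▷recs-sound k ds (λ s s∈ → Agree-pred (agrees s s∈)) ext))

        ▷rec-sound : ∀ k {T N Δ} → T ▷rec N ◇ Δ → AgreeOn (rcsC T) k → Extends G Δ →
          expC Δc k T ≡ expN G k N
        ▷rec-sound zero    _           _      _ = refl
        ▷rec-sound (suc k) tr-mv       _      _ = refl
        ▷rec-sound (suc k) (tr-rc {r}) agrees _ with agrees r (here refl)
        ... | agree _ eC eN = trans eC (sym eN)
        ▷rec-sound (suc k) (tr-con {U = U} {Δ = Δ} r (_ , _ , r∉Δ) d) agrees ext
          rewrite ext r (∈-defsF-++⁺ʳ Δ [ fdef r U ] (here refl))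
                | lookupF-++ʳ Δ [ fdef r U ] r (λ r∈ → r∉Δ (defsF⊆rcsFCtx Δ r∈))
                | lookupF-fdef r U
          = ▷con-sound (suc k) d agrees (Extends-++ˡ G Δ [ fdef r U ] ext)

        ▷recs-sound : ∀ k {n} {Ts : Vec CTerm n} {Ns Δ} → Ts ▷recs Ns ◇ Δ →
          AgreeOn (rcsCs Ts) k → Extends G Δ → expCs Δc k Ts ≡ expNs G k Ns
        ▷recs-sound k trs-[] _ _ = refl
        ▷recs-sound k (trs-∷ {T = T} {Δ = Δ} {Ts = Ts} {Δs = Δs} d ds disj) agrees ext =
          trans (expCs-∷ Δc k T Ts)
            (cong₂ mcons
              (▷rec-sound k d (λ s s∈ → agrees s (∈-++⁺ˡ s∈)) (Extends-++ˡ G Δ Δs ext))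
              (▷recs-sound k ds (λ s s∈ → agrees s (∈-++⁺ʳ (rcsC T) s∈)) (Extends-++ʳ G Δ Δs disj ext)))

theorem2p1 : (S : Signature) → let open WithSig S in
    (Δc : CCtx) (T : CTerm) (Δ₁ : FCtx) (k : ℕ) →
    (∀ s → s ∈ rcsC T →
      Σ MBot λ m → (expC Δc k (crc s) ≡ just m) × (expN Δ₁ k (nrc s) ≡ just m)) →
    let open Translation Δc Δ₁ in
    (∀ {U Δ₂} → T ▷con U ◇ Δ₂ → expC Δc k T ≡ expU (Δ₁ ,, Δ₂) k U)
    × (∀ {N Δ₂} → T ▷rec N ◇ Δ₂ → expC Δc k T ≡ expN (Δ₁ ,, Δ₂) k N)
theorem2p1 S Δc T Δ₁ k agrees =
    (λ {_} {Δ₂} d → ▷con-sound (Δ₁ ++ Δ₂) k d (agree-++ Δ₂) (extends Δ₂ (▷con-defs-fresh d)))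
  , (λ {_} {Δ₂} d → ▷rec-sound (Δ₁ ++ Δ₂) k d (agree-++ Δ₂) (extends Δ₂ (▷rec-defs-fresh d)))
  where
    open WithSig S
    open ExpansionProperties S
    open Soundness Δc Δ₁

    agree-++ : ∀ Δ₂ s → s ∈ rcsC T → Agree Δc (Δ₁ ++ Δ₂) k s
    agree-++ Δ₂ s s∈ = let m , eC , eN = agrees s s∈ in Agree-++ Δ₂ (agree m eC eN)

    extends : ∀ Δ₂ → Disjoint (defsF Δ₂) (rcsFCtx Δ₁) → Extends (Δ₁ ++ Δ₂) Δ₂
    extends Δ₂ fresh = Extends-++ Δ₁ Δ₂ (λ r∈ r∈Δ₁ → fresh r∈ (defsF⊆rcsFCtx Δ₁ r∈Δ₁))
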